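{- There exist graphs of arboricity 2 on $n$ vertices (with a $\Delta$-orientation, for outdegree threshold $\Delta$) for which, following a single edge insertion, the original Brodal–Fagerberg algorithm may increase the outdegree of some vertex to $\Omega(n/\Delta)$ during the reset cascade.
   Context: Arboricity of $G=(V,E)$: $\max_{U\subseteq V,|U|\ge2}\lceil |E(U)|/(|U|-1)\rceil$. A $\Delta$-orientation is an orientation of the edges with every outdegree at most $\Delta$. Resetting a vertex means flipping all its outgoing edges so they become incoming. The original Brodal–Fagerberg (BF) algorithm with threshold $\Delta$: a deletion removes the edge; an inserted edge is oriented arbitrarily; then, as long as some vertex has outdegree greater than $\Delta$, an arbitrary such vertex is reset (the reset cascade). "May" refers to some admissible order of resets in the cascade. -}

module Defs where

open import Data.Nat using (ℕ; zero; suc; _+_; _*_; _∸_; _≤_; _<_)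
open import Data.Bool using (Bool; true; false; if_then_else_; _∧_)
open import Data.Fin using (Fin; _≟_)
open import Data.Fin.Subset using (Subset; ∣_∣)
open import Data.Vec using (lookup)
open import Data.List using (List; []; _∷_; map)
open import Data.List.Relation.Unary.All using (All)
open import Data.List.Relation.Unary.AllPairs using (AllPairs)
open import Data.Product using (_×_; _,_; Σ; ∃)
open import Data.Sum using (_⊎_)
open import Relation.Binary.PropositionalEquality using (_≡_; _≢_)
open import Relation.Nullary using (¬_; does)

Arc : ℕ → Set
Arc n = Fin n × Fin n

-- An oriented graph on Fin n is a list of arcs; the underlying undirected
-- graph has one edge {a,b} per arc (a , b).
Oriented : ℕ → Set
Oriented n = List (Arc n)

SameEdge : ∀ {n} → Arc n → Arc n → Set
SameEdge (a , b) (c , d) = (a ≡ c × b ≡ d) ⊎ (a ≡ d × b ≡ c)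

Simple : ∀ {n} → Oriented n → Set
Simple D = All (λ { (a , b) → a ≢ b }) D × AllPairs (λ e f → ¬ SameEdge e f) D

outdeg : ∀ {n} → Oriented n → Fin n → ℕ
outdeg [] v = 0
outdeg ((a , b) ∷ D) v = if does (a ≟ v) then suc (outdeg D v) else outdeg D v

IsΔOrientation : ∀ {n} → ℕ → Oriented n → Set
IsΔOrientation Δ D = ∀ v → outdeg D v ≤ Δ

edgesIn : ∀ {n} → Subset n → Oriented n → ℕ
edgesIn U [] = 0
edgesIn U ((a , b) ∷ D) =
  if lookup U a ∧ lookup U b then suc (edgesIn U D) else edgesIn U D

-- ceiling division ⌈ m / k ⌉ ≤ t  ⇔  m ≤ t * k  (k ≥ 1), so
-- arboricity = max_{|U|≥2} ⌈|E(U)|/(|U|-1)⌉ = 2 unfolds to: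
-- every U with |U| ≥ 2 has |E(U)| ≤ 2(|U|-1), and some U with |U| ≥ 2
-- has |E(U)| > 1·(|U|-1).
ArboricityTwo : ∀ {n} → Oriented n → Set
ArboricityTwo {n} D =
  (∀ (U : Subset n) → 2 ≤ ∣ U ∣ → edgesIn U D ≤ 2 * (∣ U ∣ ∸ 1))
  × (Σ (Subset n) λ U → 2 ≤ ∣ U ∣ × ∣ U ∣ ∸ 1 < edgesIn U D)

flipIfFrom : ∀ {n} → Fin n → Arc n → Arc n
flipIfFrom v (a , b) = if does (a ≟ v) then (b , a) else (a , b)

reset : ∀ {n} → Fin n → Oriented n → Oriented n
reset v D = map (flipIfFrom v) D

-- Cascade Δ D D' : D' is reached from D by a finite sequence of resets,
-- each applied to a vertex whose current outdegree exceeds Δ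
-- (an admissible prefix of the Brodal–Fagerberg reset cascade).
data Cascade {n : ℕ} (Δ : ℕ) : Oriented n → Oriented n → Set where
  done : ∀ {D} → Cascade Δ D D
  step : ∀ {D D'} (v : Fin n) → Δ < outdeg D v → Cascade Δ (reset v D) D' → Cascade Δ D D'

-- Let Δ = d + 2.  The graph is a "fan with pendant leaves": a hub x and a
-- chain of spokes y₁, …, y_k, where y_i → x, y_i → y_{i-1} and y_i points to
-- d further pendant leaves, so every spoke has outdegree exactly Δ.  Inserting
-- one arc out of the last spoke y_k makes it overfull; resetting it reverses
-- the arc to y_{k-1}, which becomes overfull in turn, and so on down the chain.
-- Every reset of a spoke turns its arc into x around, so after k resets the hub
-- has outdegree k ≈ n / Δ.
module Submission where

open import Defs
open import Data.Nat using (ℕ; zero; suc; _+_; _*_; _∸_; _≤_; _<_; z≤n; s≤s; _≤?_)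
open import Data.Nat.Properties hiding (_≟_; suc-injective)
open import Data.Nat.DivMod using (_/_; _%_; m≡m%n+[m/n]*n; m%n<n)
open import Data.Nat.Tactic.RingSolver using (solve-∀)
open import Data.Bool using (true; false; _∧_)
open import Data.Fin using (Fin; zero; suc; _≟_)
open import Data.Fin.Properties using (suc-injective)
open import Data.Fin.Subset using (Subset; ∣_∣; ⊤)
open import Data.Fin.Subset.Properties using (∣⊤∣≡n)
open import Data.Vec using (lookup; _∷_; [])
open import Data.Vec.Properties using (lookup-replicate)
open import Data.List using ([]; _∷_; map; _++_; length)
open import Data.List.Properties using (map-++; ++-assoc; length-map)
open import Data.List.Membership.Propositional using (_∈_)
open import Data.List.Membership.Propositional.Properties using (∈-map⁺)
open import Data.List.Relation.Unary.Any using (here; there)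
open import Data.List.Relation.Unary.All as All using (All; []; _∷_)
import Data.List.Relation.Unary.All.Properties as AllP
open import Data.List.Relation.Unary.AllPairs as AllPairs using (AllPairs; []; _∷_)
import Data.List.Relation.Unary.AllPairs.Properties as AllPairsP
open import Data.Product using (_×_; _,_; Σ; proj₁; proj₂)
open import Data.Sum using (_⊎_; inj₁; inj₂)
open import Data.Empty using (⊥-elim)
open import Function.Definitions using (Injective)
open import Relation.Binary.PropositionalEquality
open import Relation.Nullary using (¬_; does; yes; no)
open import Relation.Nullary.Decidable using (dec-true)

-- Outdegree and resets under concatenation and relabelling

relabelArc : ∀ {m M} → (Fin m → Fin M) → Arc m → Arc M
relabelArc f (a , b) = f a , f b

relabel : ∀ {m M} → (Fin m → Fin M) → Oriented m → Oriented M
relabel f = map (relabelArc f)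

Embedding : ∀ {m M} → (Fin m → Fin M) → Set
Embedding = Injective _≡_ _≡_

relabel-∘ : ∀ {a b c} (g : Fin b → Fin c) (f : Fin a → Fin b) D →
            relabel g (relabel f D) ≡ relabel (λ v → g (f v)) D
relabel-∘ g f []      = refl
relabel-∘ g f (e ∷ D) = cong (_ ∷_) (relabel-∘ g f D)

does-embed : ∀ {m M} {f : Fin m → Fin M} → Embedding f →
             ∀ a v → does (f a ≟ f v) ≡ does (a ≟ v)
does-embed {f = f} f-inj a v with a ≟ v | f a ≟ f v
... | yes _   | yes _   = refl
... | yes a≡v | no fa≢  = ⊥-elim (fa≢ (cong f a≡v))
... | no a≢v  | yes fa≡ = ⊥-elim (a≢v (f-inj fa≡))
... | no _    | no _    = refl

outdeg-++ : ∀ {n} (A B : Oriented n) v → outdeg (A ++ B) v ≡ outdeg A v + outdeg B v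
outdeg-++ []            B v = refl
outdeg-++ ((a , b) ∷ A) B v with does (a ≟ v)
... | true  = cong suc (outdeg-++ A B v)
... | false = outdeg-++ A B v

outdeg-≤-++ʳ : ∀ {n} (A B : Oriented n) v → outdeg B v ≤ outdeg (A ++ B) v
outdeg-≤-++ʳ A B v = subst (outdeg B v ≤_) (sym (outdeg-++ A B v)) (m≤n+m _ _)

outdeg-≤-∷ : ∀ {n} (e : Arc n) D v → outdeg D v ≤ outdeg (e ∷ D) v
outdeg-≤-∷ e D v = outdeg-≤-++ʳ (e ∷ []) D v

outdeg-relabel : ∀ {m M} (f : Fin m → Fin M) → Embedding f →
                 ∀ D v → outdeg (relabel f D) (f v) ≡ outdeg D v
outdeg-relabel f f-inj []            v = refl
outdeg-relabel f f-inj ((a , b) ∷ D) v rewrite does-embed f-inj a v with does (a ≟ v)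
... | true  = cong suc (outdeg-relabel f f-inj D v)
... | false = outdeg-relabel f f-inj D v

outdeg-relabel-outside : ∀ {m M} (f : Fin m → Fin M) v → (∀ a → f a ≢ v) →
                         ∀ D → outdeg (relabel f D) v ≡ 0
outdeg-relabel-outside f v v∉f []            = refl
outdeg-relabel-outside f v v∉f ((a , b) ∷ D) with f a ≟ v
... | yes fa≡v = ⊥-elim (v∉f a fa≡v)
... | no _     = outdeg-relabel-outside f v v∉f D

reset-relabel : ∀ {m M} (f : Fin m → Fin M) → Embedding f →
                ∀ v D → reset (f v) (relabel f D) ≡ relabel f (reset v D)
reset-relabel f f-inj v []            = refl
reset-relabel f f-inj v ((a , b) ∷ D) rewrite does-embed f-inj a v with does (a ≟ v)
... | true  = cong (_ ∷_) (reset-relabel f f-inj v D)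
... | false = cong (_ ∷_) (reset-relabel f f-inj v D)

reset-relabel-outside : ∀ {m M} (f : Fin m → Fin M) v → (∀ a → f a ≢ v) →
                        ∀ D → reset v (relabel f D) ≡ relabel f D
reset-relabel-outside f v v∉f []            = refl
reset-relabel-outside f v v∉f ((a , b) ∷ D) with f a ≟ v
... | yes fa≡v = ⊥-elim (v∉f a fa≡v)
... | no _     = cong (_ ∷_) (reset-relabel-outside f v v∉f D)

outdeg-reset-other : ∀ {n} (D : Oriented n) (u v : Fin n) → u ≢ v →
                     outdeg D u ≤ outdeg (reset v D) u
outdeg-reset-other []            u v u≢v = z≤n
outdeg-reset-other ((a , b) ∷ D) u v u≢v with a ≟ v
... | yes refl with a ≟ u
...   | yes refl = ⊥-elim (u≢v refl)
...   | no _ with does (b ≟ u)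
...     | true  = ≤-trans (outdeg-reset-other D u a u≢v) (n≤1+n _)
...     | false = outdeg-reset-other D u a u≢v
outdeg-reset-other ((a , b) ∷ D) u v u≢v | no _ with does (a ≟ u)
...   | true  = s≤s (outdeg-reset-other D u v u≢v)
...   | false = outdeg-reset-other D u v u≢v

reset-reverses : ∀ {n} {v w : Fin n} {D : Oriented n} → (v , w) ∈ D →
                 1 ≤ outdeg (reset v D) w
reset-reverses {v = v} {w} (here refl) rewrite dec-true (v ≟ v) refl | dec-true (w ≟ w) refl = s≤s z≤n
reset-reverses {v = v} {D = e ∷ D} (there vw∈D) =
  ≤-trans (reset-reverses vw∈D) (outdeg-≤-∷ (flipIfFrom v e) (reset v D) _)

-- The shape of the graph during the cascade: arcs E, then the image under f
-- of a gadget B around y, then a part A embedded through s away from y.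
-- Resetting f y touches only E and the gadget.
reset-layered : ∀ {m m' M} (f : Fin m → Fin M) → Embedding f →
                (s : Fin m' → Fin m) (y : Fin m) → (∀ a → s a ≢ y) → ∀ E B A →
                reset (f y) (E ++ relabel f (B ++ relabel s A))
                  ≡ (reset (f y) E ++ relabel f (reset y B)) ++ relabel (λ v → f (s v)) A
reset-layered f f-inj s y y∉s E B A = begin
  reset (f y) (E ++ relabel f (B ++ relabel s A))
    ≡⟨ map-++ (flipIfFrom (f y)) E _ ⟩
  reset (f y) E ++ reset (f y) (relabel f (B ++ relabel s A))
    ≡⟨ cong (reset (f y) E ++_) (reset-relabel f f-inj y _) ⟩
  reset (f y) E ++ relabel f (reset y (B ++ relabel s A))
    ≡⟨ cong (λ X → reset (f y) E ++ relabel f X) (map-++ (flipIfFrom y) B _) ⟩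
  reset (f y) E ++ relabel f (reset y B ++ reset y (relabel s A))
    ≡⟨ cong (λ X → reset (f y) E ++ relabel f (reset y B ++ X)) (reset-relabel-outside s y y∉s A) ⟩
  reset (f y) E ++ relabel f (reset y B ++ relabel s A)
    ≡⟨ cong (reset (f y) E ++_) (map-++ (relabelArc f) (reset y B) _) ⟩
  reset (f y) E ++ (relabel f (reset y B) ++ relabel f (relabel s A))
    ≡⟨ cong (λ X → reset (f y) E ++ (relabel f (reset y B) ++ X)) (relabel-∘ f s A) ⟩
  reset (f y) E ++ (relabel f (reset y B) ++ relabel (λ v → f (s v)) A)
    ≡⟨ sym (++-assoc (reset (f y) E) _ _) ⟩
  (reset (f y) E ++ relabel f (reset y B)) ++ relabel (λ v → f (s v)) A ∎
  where open ≡-Reasoning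

-- 2-degenerate constructions: simple, with |E(U)| ≤ 2(|U| - 1)

data NewArcs {m : ℕ} : Oriented (suc m) → Set where
  none    : NewArcs []
  inArc   : ∀ t → NewArcs ((suc t , zero) ∷ [])
  outArc  : ∀ t → NewArcs ((zero , suc t) ∷ [])
  outArcs : ∀ t t' → t ≢ t' → NewArcs ((zero , suc t) ∷ (zero , suc t') ∷ [])

data Degenerate : (m : ℕ) → Oriented m → Set where
  empty  : Degenerate 0 []
  extend : ∀ {m D} (A : Oriented (suc m)) → NewArcs A → Degenerate m D →
           Degenerate (suc m) (A ++ relabel suc D)

edgesIn-++ : ∀ {n} (U : Subset n) A B → edgesIn U (A ++ B) ≡ edgesIn U A + edgesIn U B
edgesIn-++ U []            B = refl
edgesIn-++ U ((a , b) ∷ A) B with lookup U a ∧ lookup U b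
... | true  = cong suc (edgesIn-++ U A B)
... | false = edgesIn-++ U A B

edgesIn-relabel-suc : ∀ {n} x (U : Subset n) D → edgesIn (x ∷ U) (relabel suc D) ≡ edgesIn U D
edgesIn-relabel-suc x U []            = refl
edgesIn-relabel-suc x U ((a , b) ∷ D) with lookup U a ∧ lookup U b
... | true  = cong suc (edgesIn-relabel-suc x U D)
... | false = edgesIn-relabel-suc x U D

∈-nonempty : ∀ {n} (U : Subset n) t → lookup U t ≡ true → 1 ≤ ∣ U ∣
∈-nonempty (true  ∷ U) zero    _  = s≤s z≤n
∈-nonempty (true  ∷ U) (suc t) _  = s≤s z≤n
∈-nonempty (false ∷ U) (suc t) t∈ = ∈-nonempty U t t∈

room-for-two : ∀ c e u → c ≤ 2 → e ≤ 2 * (u ∸ 1) → 1 ≤ u → c + e ≤ 2 * u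
room-for-two c e (suc u) c≤2 e≤ _ =
  ≤-trans (+-mono-≤ c≤2 e≤) (≤-reflexive (sym (*-distribˡ-+ 2 1 u)))

-- The new arcs lie inside x ∷ U only if x is in U, and then there are at most
-- two of them, each needing a neighbour in U.
newArcs-bound : ∀ {m} {A : Oriented (suc m)} → NewArcs A → ∀ x (U : Subset m) e →
                e ≤ 2 * (∣ U ∣ ∸ 1) → edgesIn (x ∷ U) A + e ≤ 2 * (∣ x ∷ U ∣ ∸ 1)
newArcs-bound none false U e e≤ = e≤
newArcs-bound (inArc t) false U e e≤ with lookup U t
... | true  = e≤
... | false = e≤
newArcs-bound (outArc t) false U e e≤ = e≤
newArcs-bound (outArcs t t' _) false U e e≤ = e≤
newArcs-bound none true U e e≤ = ≤-trans e≤ (*-monoʳ-≤ 2 (m∸n≤m ∣ U ∣ 1))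
newArcs-bound (inArc t) true U e e≤ with lookup U t in t∈
... | true  = room-for-two 1 e _ (s≤s z≤n) e≤ (∈-nonempty U t t∈)
... | false = ≤-trans e≤ (*-monoʳ-≤ 2 (m∸n≤m ∣ U ∣ 1))
newArcs-bound (outArc t) true U e e≤ with lookup U t in t∈
... | true  = room-for-two 1 e _ (s≤s z≤n) e≤ (∈-nonempty U t t∈)
... | false = ≤-trans e≤ (*-monoʳ-≤ 2 (m∸n≤m ∣ U ∣ 1))
newArcs-bound (outArcs t t' _) true U e e≤ with lookup U t in t∈ | lookup U t' in t'∈
... | true  | true  = room-for-two 2 e _ ≤-refl e≤ (∈-nonempty U t t∈)
... | true  | false = room-for-two 1 e _ (s≤s z≤n) e≤ (∈-nonempty U t t∈)
... | false | true  = room-for-two 1 e _ (s≤s z≤n) e≤ (∈-nonempty U t' t'∈)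
... | false | false = ≤-trans e≤ (*-monoʳ-≤ 2 (m∸n≤m ∣ U ∣ 1))

degenerate-sparse : ∀ {m D} → Degenerate m D → ∀ (U : Subset m) → edgesIn U D ≤ 2 * (∣ U ∣ ∸ 1)
degenerate-sparse empty [] = z≤n
degenerate-sparse (extend {D = D} A new deg) (x ∷ U)
  rewrite edgesIn-++ (x ∷ U) A (relabel suc D) | edgesIn-relabel-suc x U D =
  newArcs-bound new x U _ (degenerate-sparse deg U)

data AtZero {m : ℕ} : Arc (suc m) → Set where
  fromZero : ∀ t → AtZero (zero , suc t)
  toZero   : ∀ t → AtZero (suc t , zero)

atZero-fresh : ∀ {m} {e : Arc (suc m)} → AtZero e → ∀ D → All (λ f → ¬ SameEdge e f) (relabel suc D)
atZero-fresh z [] = []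
atZero-fresh z ((c , d) ∷ D) = fresh z ∷ atZero-fresh z D
  where
  fresh : ∀ {e} → AtZero e → ¬ SameEdge e (suc c , suc d)
  fresh (fromZero t) (inj₁ (() , _))
  fresh (fromZero t) (inj₂ (() , _))
  fresh (toZero t)   (inj₁ (_ , ()))
  fresh (toZero t)   (inj₂ (_ , ()))

newArcs-atZero : ∀ {m} {A : Oriented (suc m)} → NewArcs A → All AtZero A
newArcs-atZero none             = []
newArcs-atZero (inArc t)        = toZero t ∷ []
newArcs-atZero (outArc t)       = fromZero t ∷ []
newArcs-atZero (outArcs t t' _) = fromZero t ∷ fromZero t' ∷ []

newArcs-simple : ∀ {m} {A : Oriented (suc m)} → NewArcs A → Simple A
newArcs-simple none             = [] , []
newArcs-simple (inArc t)        = (λ ()) ∷ [] , [] ∷ []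
newArcs-simple (outArc t)       = (λ ()) ∷ [] , [] ∷ []
newArcs-simple (outArcs t t' t≢t') = (λ ()) ∷ (λ ()) ∷ [] , (distinct ∷ []) ∷ [] ∷ []
  where
  distinct : ¬ SameEdge (zero , suc t) (zero , suc t')
  distinct (inj₁ (_ , st≡st')) = t≢t' (suc-injective st≡st')
  distinct (inj₂ (() , _))

sameEdge-suc : ∀ {m} (e f : Arc m) → SameEdge (relabelArc suc e) (relabelArc suc f) → SameEdge e f
sameEdge-suc _ _ (inj₁ (p , q)) = inj₁ (suc-injective p , suc-injective q)
sameEdge-suc _ _ (inj₂ (p , q)) = inj₂ (suc-injective p , suc-injective q)

degenerate-simple : ∀ {m D} → Degenerate m D → Simple D
degenerate-simple empty = [] , []
degenerate-simple (extend {D = D} A new deg) with degenerate-simple deg | newArcs-simple new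
... | loopless , distinct | loopless₀ , distinct₀ =
  AllP.++⁺ loopless₀ (AllP.map⁺ (All.map (λ a≢b sa≡sb → a≢b (suc-injective sa≡sb)) loopless)) ,
  AllPairsP.++⁺ distinct₀
    (AllPairsP.map⁺ (AllPairs.map (λ {e} {f} e≁f same → e≁f (sameEdge-suc e f same)) distinct))
    (All.map (λ z → atZero-fresh z D) (newArcs-atZero new))

-- The fan with pendant leaves

-- A graph with two marked vertices: the current end of the spoke chain and the hub.
record Marked (m : ℕ) : Set where
  constructor marked
  field
    arcs : Oriented m
    top  : Fin m
    hub  : Fin m
open Marked

-- Two isolated vertices: the bottom of the chain and the hub.
seed : Marked 2
seed = marked [] zero (suc zero)

-- New vertex 0 with a pendant arc 0 → hub (used only to pad the vertex count).
pendant : ∀ {m} → Marked m → Marked (suc m)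
pendant G = marked ((zero , suc (hub G)) ∷ relabel suc (arcs G)) (suc (top G)) (suc (hub G))

spoke : ∀ {m} → Marked m → Marked (suc m)
spoke G = marked ((zero , suc (top G)) ∷ (zero , suc (hub G)) ∷ relabel suc (arcs G)) zero (suc (hub G))

leaf : ∀ {m} → Marked m → Marked (suc m)
leaf G = marked ((suc (top G) , zero) ∷ relabel suc (arcs G)) (suc (top G)) (suc (hub G))

pendants : (p : ℕ) → Marked (p + 2)
pendants zero    = seed
pendants (suc p) = pendant (pendants p)

leaves : ∀ {m} (t : ℕ) → Marked m → Marked (t + m)
leaves zero    G = G
leaves (suc t) G = leaf (leaves t G)

-- The position of an old vertex of G inside leaves t (spoke G).
shift : ∀ {m} (t : ℕ) → Fin m → Fin (t + suc m)
shift zero    v = suc v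
shift (suc t) v = suc (shift t v)

shift-embedding : ∀ {m} t → Embedding (shift {m} t)
shift-embedding zero    eq = suc-injective eq
shift-embedding (suc t) eq = shift-embedding t (suc-injective eq)

shift-avoids-top : ∀ {m} t (G : Marked m) a → shift t a ≢ top (leaves t (spoke G))
shift-avoids-top zero    G a ()
shift-avoids-top (suc t) G a eq = shift-avoids-top t G a (suc-injective eq)

hub-leaves : ∀ {m} t (G : Marked m) → hub (leaves t (spoke G)) ≡ shift t (hub G)
hub-leaves zero    G = refl
hub-leaves (suc t) G = cong suc (hub-leaves t G)

-- The arcs added by spoke and t leaves: all of them leave the new spoke.
gadget : ∀ {m} (t : ℕ) → Marked m → Oriented (t + suc m)
gadget zero    G = (zero , suc (top G)) ∷ (zero , suc (hub G)) ∷ []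
gadget (suc t) G = (suc (top (leaves t (spoke G))) , zero) ∷ relabel suc (gadget t G)

gadget-decomposition : ∀ {m} t (G : Marked m) →
                       arcs (leaves t (spoke G)) ≡ gadget t G ++ relabel (shift t) (arcs G)
gadget-decomposition zero    G = refl
gadget-decomposition (suc t) G = cong ((suc (top (leaves t (spoke G))) , zero) ∷_) (begin
  relabel suc (arcs (leaves t (spoke G)))
    ≡⟨ cong (relabel suc) (gadget-decomposition t G) ⟩
  relabel suc (gadget t G ++ relabel (shift t) (arcs G))
    ≡⟨ map-++ (relabelArc suc) (gadget t G) _ ⟩
  relabel suc (gadget t G) ++ relabel suc (relabel (shift t) (arcs G))
    ≡⟨ cong (relabel suc (gadget t G) ++_) (relabel-∘ suc (shift t) (arcs G)) ⟩
  relabel suc (gadget t G) ++ relabel (shift (suc t)) (arcs G) ∎)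
  where open ≡-Reasoning

spoke-arc : ∀ {m} t (G : Marked m) {v} → v ≡ top G ⊎ v ≡ hub G →
            (top (leaves t (spoke G)) , shift t v) ∈ gadget t G
spoke-arc zero    G (inj₁ refl) = here refl
spoke-arc zero    G (inj₂ refl) = there (here refl)
spoke-arc (suc t) G v∈          = there (∈-map⁺ (relabelArc suc) (spoke-arc t G v∈))

outdeg-top : ∀ {m} t (G : Marked m) → outdeg (arcs (leaves t (spoke G))) (top (leaves t (spoke G))) ≡ t + 2
outdeg-top zero G rewrite outdeg-relabel-outside suc zero (λ _ ()) (arcs G) = refl
outdeg-top (suc t) G
  rewrite dec-true (top (leaves t (spoke G)) ≟ top (leaves t (spoke G))) refl
        | outdeg-relabel suc suc-injective (arcs (leaves t (spoke G))) (top (leaves t (spoke G))) =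
  cong suc (outdeg-top t G)

outdeg-non-top : ∀ {m} t (G : Marked m) Δ → (∀ v → outdeg (arcs G) v ≤ Δ) →
                 ∀ v → v ≢ top (leaves t (spoke G)) → outdeg (arcs (leaves t (spoke G))) v ≤ Δ
outdeg-non-top zero G Δ G≤ zero v≢ = ⊥-elim (v≢ refl)
outdeg-non-top zero G Δ G≤ (suc v) _ rewrite outdeg-relabel suc suc-injective (arcs G) v = G≤ v
outdeg-non-top (suc t) G Δ G≤ zero _
  rewrite outdeg-relabel-outside suc zero (λ _ ()) (arcs (leaves t (spoke G))) = z≤n
outdeg-non-top (suc t) G Δ G≤ (suc v) v≢ with top (leaves t (spoke G)) ≟ v
... | yes top≡v = ⊥-elim (v≢ (cong suc (sym top≡v)))
... | no top≢v rewrite outdeg-relabel suc suc-injective (arcs (leaves t (spoke G))) v =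
  outdeg-non-top t G Δ G≤ v (λ v≡top → top≢v (sym v≡top))

length-leaves : ∀ {m} t (G : Marked m) → length (arcs (leaves t (spoke G))) ≡ t + 2 + length (arcs G)
length-leaves zero    G = cong (λ l → suc (suc l)) (length-map (relabelArc suc) (arcs G))
length-leaves (suc t) G =
  cong suc (trans (length-map (relabelArc suc) (arcs (leaves t (spoke G)))) (length-leaves t G))

-- Level k of the fan: p pendant vertices on the hub and k spokes, each with
-- d leaves, so that every spoke has outdegree d + 2.
module Fan (d p : ℕ) where

  size : ℕ → ℕ
  size zero    = p + 2
  size (suc k) = d + suc (size k)

  level : (k : ℕ) → Marked (size k)
  level zero    = pendants p
  level (suc k) = leaves d (spoke (level k))

  top≢hub : ∀ k → top (level k) ≢ hub (level k)
  top≢hub zero = pendants-top≢hub p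
    where
    pendants-top≢hub : ∀ q → top (pendants q) ≢ hub (pendants q)
    pendants-top≢hub zero    ()
    pendants-top≢hub (suc q) eq = pendants-top≢hub q (suc-injective eq)
  top≢hub (suc k) eq = shift-avoids-top d (level k) (hub (level k)) (sym (trans eq (hub-leaves d (level k))))

  level-degenerate : ∀ k → Degenerate (size k) (arcs (level k))
  level-degenerate zero    = pendants-degenerate p
    where
    pendants-degenerate : ∀ q → Degenerate (q + 2) (arcs (pendants q))
    pendants-degenerate zero    = extend [] none (extend [] none empty)
    pendants-degenerate (suc q) = extend _ (outArc _) (pendants-degenerate q)
  level-degenerate (suc k) = leaves-degenerate d
    where
    leaves-degenerate : ∀ t → Degenerate (t + suc (size k)) (arcs (leaves t (spoke (level k))))
    leaves-degenerate zero    = extend _ (outArcs _ _ (top≢hub k)) (level-degenerate k)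
    leaves-degenerate (suc t) = extend _ (inArc _) (leaves-degenerate t)

  level-orientation : ∀ k v → outdeg (arcs (level k)) v ≤ d + 2
  level-orientation zero    = pendants-orientation p
    where
    pendants-orientation : ∀ q v → outdeg (arcs (pendants q)) v ≤ d + 2
    pendants-orientation zero    v = z≤n
    pendants-orientation (suc q) zero
      rewrite outdeg-relabel-outside suc zero (λ _ ()) (arcs (pendants q)) = ≤-trans (s≤s z≤n) (m≤n+m 2 d)
    pendants-orientation (suc q) (suc v)
      rewrite outdeg-relabel suc suc-injective (arcs (pendants q)) v = pendants-orientation q v
  level-orientation (suc k) v with v ≟ top (level (suc k))
  ... | yes refl = ≤-reflexive (outdeg-top d (level k))
  ... | no v≢top = outdeg-non-top d (level k) (d + 2) (level-orientation k) v v≢top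

  size-formula : ∀ k → size k ≡ p + 2 + k * (d + 1)
  size-formula zero    = sym (+-identityʳ (p + 2))
  size-formula (suc k) = trans (cong (λ s → d + suc s) (size-formula k)) (rearrange p d k)
    where
    rearrange : ∀ p d k → d + suc (p + 2 + k * (d + 1)) ≡ p + 2 + suc k * (d + 1)
    rearrange = solve-∀

  edge-count : ∀ k → length (arcs (level k)) ≡ p + k * (d + 2)
  edge-count zero    = trans (pendants-count p) (sym (+-identityʳ p))
    where
    pendants-count : ∀ q → length (arcs (pendants q)) ≡ q
    pendants-count zero    = refl
    pendants-count (suc q) = cong suc (trans (length-map (relabelArc suc) (arcs (pendants q))) (pendants-count q))
  edge-count (suc k) = trans (length-leaves d (level k)) (trans (cong (d + 2 +_) (edge-count k)) (rearrange p d k))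
    where
    rearrange : ∀ p d k → d + 2 + (p + k * (d + 2)) ≡ p + suc k * (d + 2)
    rearrange = solve-∀

  cascade : ∀ k {M} (f : Fin (size k) → Fin M) → Embedding f → (E : Oriented M) →
            1 ≤ outdeg E (f (top (level k))) →
            Σ (Oriented M) λ D' → Cascade (d + 2) (E ++ relabel f (arcs (level k))) D' ×
              k + outdeg E (f (hub (level k))) ≤ outdeg D' (f (hub (level k)))
  cascade zero f f-inj E _ = _ , done , ≤-trans (m≤m+n _ _) (≤-reflexive (sym (outdeg-++ E _ _)))
  cascade (suc k) f f-inj E top-out =
    D' , step (f y) overfull (subst (λ X → Cascade (d + 2) X D') (sym after-reset) cascade-below) ,
    hub-bound
    where
    G = level k
    y = top (level (suc k))
    x = hub G
    f' : Fin (size k) → Fin _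
    f' v = f (shift d v)
    B = gadget d G
    E₁ = reset (f y) E ++ relabel f (reset y B)

    overfull : d + 2 < outdeg (E ++ relabel f (arcs (level (suc k)))) (f y)
    overfull rewrite outdeg-++ E (relabel f (arcs (level (suc k)))) (f y)
                   | outdeg-relabel f f-inj (arcs (level (suc k))) y
                   | outdeg-top d G = +-monoˡ-≤ (d + 2) top-out

    after-reset : reset (f y) (E ++ relabel f (arcs (level (suc k)))) ≡ E₁ ++ relabel f' (arcs G)
    after-reset = trans (cong (λ X → reset (f y) (E ++ relabel f X)) (gadget-decomposition d G))
                        (reset-layered f f-inj (shift d) y (shift-avoids-top d G) E B (arcs G))

    -- Resetting y reverses its arcs to the old top and the hub.
    reversed : ∀ {v} → v ≡ top G ⊎ v ≡ x → 1 ≤ outdeg E₁ (f' v)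
    reversed {v} v∈ = ≤-trans (reset-reverses (spoke-arc d G v∈))
      (≤-trans (≤-reflexive (sym (outdeg-relabel f f-inj (reset y B) (shift d v))))
               (outdeg-≤-++ʳ (reset (f y) E) _ _))

    recursion = cascade k f' (λ eq → shift-embedding d (f-inj eq)) E₁ (reversed (inj₁ refl))
    D' = proj₁ recursion
    cascade-below = proj₁ (proj₂ recursion)

    hub-gain : suc (outdeg E (f' x)) ≤ outdeg E₁ (f' x)
    hub-gain rewrite outdeg-++ (reset (f y) E) (relabel f (reset y B)) (f' x)
                   | outdeg-relabel f f-inj (reset y B) (shift d x) =
      ≤-trans (≤-reflexive (+-comm 1 _))
        (+-mono-≤ (outdeg-reset-other E (f' x) (f y) (λ eq → shift-avoids-top d G x (f-inj eq)))
                  (reset-reverses (spoke-arc d G (inj₂ refl))))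

    hub-bound : suc k + outdeg E (f (hub (level (suc k)))) ≤ outdeg D' (f (hub (level (suc k))))
    hub-bound rewrite hub-leaves d G =
      ≤-trans (≤-reflexive (sym (+-suc k _))) (≤-trans (+-monoʳ-≤ k hub-gain) (proj₂ (proj₂ recursion)))

LargeOutdegree : ℕ → ℕ → ℕ → Set
LargeOutdegree c Δ n =
  Σ (Oriented n) λ D → Simple D × ArboricityTwo D × IsΔOrientation Δ D ×
  Σ (Fin n) λ u → Σ (Fin n) λ w → u ≢ w × All (λ e → ¬ SameEdge (u , w) e) D ×
  Σ (Oriented n) λ D' → Cascade Δ ((u , w) ∷ D) D' ×
  Σ (Fin n) λ x → n ≤ c * Δ * outdeg D' x

edgesIn-all : ∀ {n} (D : Oriented n) → edgesIn ⊤ D ≡ length D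
edgesIn-all []            = refl
edgesIn-all ((a , b) ∷ D) rewrite lookup-replicate a true | lookup-replicate b true = cong suc (edgesIn-all D)

-- With at least three spokes, the whole fan has more edges than a forest.
dense-enough : ∀ p d k → 3 ≤ k → suc (p + 2 + k * (d + 1)) ∸ 1 < p + k * (d + 2)
dense-enough p d k k≥3 =
  subst₂ _≤_ (sym (vertices p d k)) (sym (edges p d k)) (+-monoʳ-≤ (p + k * (d + 1)) k≥3)
  where
  vertices : ∀ p d k → suc (p + 2 + k * (d + 1)) ≡ p + k * (d + 1) + 3
  vertices = solve-∀
  edges : ∀ p d k → p + k * (d + 2) ≡ p + k * (d + 1) + k
  edges = solve-∀

few-vertices : ∀ p d k → p ≤ d → 1 ≤ k → suc (p + 2 + k * (d + 1)) ≤ 3 * (d + 2) * k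
few-vertices p d (suc j) p≤d _ =
  subst (suc (p + 2 + suc j * (d + 1)) ≤_) (sym (rearrange d j))
        (≤-trans (+-monoˡ-≤ _ (s≤s (+-monoˡ-≤ 2 p≤d))) (m≤m+n _ _))
  where
  rearrange : ∀ d j → 3 * (d + 2) * suc j ≡ suc (d + 2 + suc j * (d + 1)) + (d + 2 + j * (2 * d + 5))
  rearrange = solve-∀

-- Fan d p with k ≥ 3 spokes, plus a fresh vertex 0 that receives the inserted
-- arc from the top spoke.
fan-instance : ∀ d p k → p ≤ d → 3 ≤ k → LargeOutdegree 3 (d + 2) (suc (Fan.size d p k))
fan-instance d p k p≤d k≥3 =
  D , degenerate-simple D-degenerate ,
  ((λ U _ → degenerate-sparse D-degenerate U) , (⊤ , two-vertices , dense)) , orientation ,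
  suc (top G) , zero , (λ ()) , atZero-fresh (toZero (top G)) (arcs G) ,
  proj₁ run , proj₁ (proj₂ run) , suc (hub G) , hub-large
  where
  open Fan d p
  G = level k
  D = relabel suc (arcs G)
  D-degenerate : Degenerate (suc (size k)) D
  D-degenerate = extend [] none (level-degenerate k)
  two-vertices : 2 ≤ ∣ ⊤ {suc (size k)} ∣
  two-vertices rewrite ∣⊤∣≡n (suc (size k)) | size-formula k = s≤s (≤-trans (s≤s z≤n) (≤-trans (m≤n+m 2 p) (m≤m+n (p + 2) _)))
  dense : ∣ ⊤ {suc (size k)} ∣ ∸ 1 < edgesIn ⊤ D
  dense rewrite ∣⊤∣≡n (suc (size k)) | edgesIn-all D | length-map (relabelArc suc) (arcs G)
              | edge-count k | size-formula k = dense-enough p d k k≥3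
  orientation : IsΔOrientation (d + 2) D
  orientation zero    rewrite outdeg-relabel-outside suc zero (λ _ ()) (arcs G) = z≤n
  orientation (suc v) rewrite outdeg-relabel suc suc-injective (arcs G) v = level-orientation k v
  inserted : 1 ≤ outdeg ((suc (top G) , zero) ∷ []) (suc (top G))
  inserted rewrite dec-true (top G ≟ top G) refl = s≤s z≤n
  run = cascade k suc suc-injective ((suc (top G) , zero) ∷ []) inserted
  hub-large : suc (size k) ≤ 3 * (d + 2) * outdeg (proj₁ run) (suc (hub G))
  hub-large = begin
    suc (size k)                             ≡⟨ cong suc (size-formula k) ⟩
    suc (p + 2 + k * (d + 1))                ≤⟨ few-vertices p d k p≤d (≤-trans (s≤s z≤n) k≥3) ⟩
    3 * (d + 2) * k                          ≤⟨ *-monoʳ-≤ (3 * (d + 2)) (≤-trans (m≤m+n k _) (proj₂ (proj₂ run))) ⟩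
    3 * (d + 2) * outdeg (proj₁ run) (suc (hub G)) ∎
    where open ≤-Reasoning

fan-size : ∀ d n → 3 * (d + 2) ≤ n →
           Σ ℕ λ p → Σ ℕ λ k → p ≤ d × 3 ≤ k × n ≡ suc (Fan.size d p k)
fan-size d n n≥ = p , k , p≤d , k≥3 , trans n≡ (cong suc (sym (Fan.size-formula d p k)))
  where
  k = (n ∸ 3) / suc d
  p = (n ∸ 3) % suc d
  p≤d : p ≤ d
  p≤d = ≤-pred (m%n<n (n ∸ 3) (suc d))
  threeΔ : ∀ d → 3 * (d + 2) ≡ suc (3 + (d + 2 * suc d))
  threeΔ = solve-∀
  three≤n : 3 ≤ n
  three≤n = ≤-trans (≤-trans (m≤m+n 3 _) (n≤1+n _)) (subst (_≤ n) (threeΔ d) n≥)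
  regroup : ∀ p d k → 3 + (p + k * suc d) ≡ suc (p + 2 + k * (d + 1))
  regroup = solve-∀
  n≡ : n ≡ suc (p + 2 + k * (d + 1))
  n≡ = trans (sym (m+[n∸m]≡n three≤n))
             (trans (cong (3 +_) (m≡m%n+[m/n]*n (n ∸ 3) (suc d))) (regroup p d k))
  -- With k ≤ 2 spokes the size would stay below 3(d + 2).
  k≥3 : 3 ≤ k
  k≥3 with 3 ≤? k
  ... | yes k≥3 = k≥3
  ... | no k≱3 = ⊥-elim (<⇒≱ n<3Δ n≥)
    where
    n<3Δ : n < 3 * (d + 2)
    n<3Δ = ≤-trans (s≤s (≤-reflexive (trans n≡ (sym (regroup p d k)))))
             (≤-trans (s≤s (+-monoʳ-≤ 3 (+-mono-≤ p≤d (*-monoˡ-≤ (suc d) (≤-pred (≰⇒> k≱3))))))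
                      (≤-reflexive (sym (threeΔ d))))

lemma3 : Σ ℕ λ c → Σ ℕ λ Δ₀ → 1 ≤ c × (∀ (Δ : ℕ) → Δ₀ ≤ Δ → ∀ (n : ℕ) → c * Δ ≤ n →
    Σ (Oriented n) λ D → Simple D × ArboricityTwo D × IsΔOrientation Δ D ×
    Σ (Fin n) λ u → Σ (Fin n) λ w → u ≢ w × All (λ e → ¬ SameEdge (u , w) e) D ×
    Σ (Oriented n) λ D' → Cascade Δ ((u , w) ∷ D) D' ×
    Σ (Fin n) λ x → n ≤ c * Δ * outdeg D' x)
lemma3 = 3 , 2 , s≤s z≤n , instance-for
  where
  instance-for : ∀ Δ → 2 ≤ Δ → ∀ n → 3 * Δ ≤ n → LargeOutdegree 3 Δ n
  instance-for Δ Δ≥2 n n≥ with Δ ∸ 2 | m∸n+n≡m Δ≥2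
  ... | d | refl with fan-size d n n≥
  ...   | p , k , p≤d , k≥3 , refl = fan-instance d p k p≤d k≥3
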